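{- For all addressing machines $M,N\in\mathcal{M}$: $M\equiv_{\mathbb{A}}N$ if and only if there exists $Z\in\mathcal{M}$ with $M\twoheadrightarrow_c Z$ and $N\twoheadrightarrow_c Z$.
   Context: Addressing machines. Fix a countable set $\mathbb{A}$ of addresses and a symbol $\varnothing\notin\mathbb{A}$; put $\mathbb{A}_\varnothing=\mathbb{A}\cup\{\varnothing\}$. A tape is a finite list $[a_1,\dots,a_n]$ of elements of $\mathbb{A}$; $a::T$ is the tape with head $a$ and tail $T$, and $T@T'$ is concatenation. A program is a finite list of instructions generated by the grammar $P::=\mathtt{Load}\ i;P\mid A$, $A::=\mathtt{App}(i,j,k);A\mid C$, $C::=\mathtt{Call}\ i\mid\varepsilon$ with $i,j,k\in\mathbb{N}$. For $r\in\mathbb{N}$ and $I\subseteq\{0,\dots,r-1\}$, $I\models^r P$ is the least relation such that: $I\models^r\varepsilon$; $I\models^r\mathtt{Call}\ i$ if $i\in I$; $I\models^r\mathtt{App}(i,j,k);A$ if $i,j\in I$ and either ($k<r$ and $I\cup\{k\}\models^r A$) or ($k\ge r$ and $I\models^r A$); $I\models^r\mathtt{Load}\ i;P$ if either ($i<r$ and $I\cup\{i\}\models^r P$) or ($i\ge r$ and $I\models^r P$). An addressing machine is $M=\langle R_0,\dots,R_{r-1},P,T\rangle$ with registers $R_i\in\mathbb{A}_\varnothing$, a program $P$ valid w.r.t. the registers (i.e. $\{i<r\mid R_i\ne\varnothing\}\models^r P$) and a tape $T$; $\mathcal{M}$ is the set of all addressing machines, with components $M.r,M.\vec R,M.R_i,M.P,M.T$.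 $\vec R[R_i:=a]$ is $\vec R$ with $R_i$ replaced by $a$ if $i<r$, unchanged if $i\ge r$. Fix a bijection $\#:\mathcal{M}\to\mathbb{A}$ with inverse $\#^{ -1}$. $M@T'=\langle M.\vec R,M.P,M.T@T'\rangle$; $a\cdot b=\#(\#^{ -1}(a)@[b])$. Head reduction $\to_h$: $\langle\vec R,\mathtt{Load}\ i;P,a::T\rangle\to_h\langle\vec R[R_i:=a],P,T\rangle$, $\langle\vec R,\mathtt{App}(i,j,k);P,T\rangle\to_h\langle\vec R[R_k:=R_i\cdot R_j],P,T\rangle$, $\langle\vec R,\mathtt{Call}\ i,T\rangle\to_h\#^{ -1}(R_i)@T$; $\twoheadrightarrow_h$ its reflexive-transitive closure. Induced relations: for a relation $\equiv_R$ on $\mathcal{M}$, $a\simeq_R b$ iff $\#^{ -1}(a)\equiv_R\#^{ -1}(b)$; on $\mathbb{A}_\varnothing$, both $\varnothing$ or both addresses related; componentwise on tuples/tapes of equal length; $M=_R N$ iff $M.\vec R\simeq_R N.\vec R$, $M.P=N.P$, $M.T\simeq_R N.T$. $\equiv_{\mathbb{A}}$ is the least equivalence relation on $\mathcal{M}$ such that $M\twoheadrightarrow_h Z$ and $Z=_{\mathbb{A}}N$ imply $M\equiv_{\mathbb{A}}N$ ($=_{\mathbb{A}}$ induced by $\equiv_{\mathbb{A}}$). The reduction $\to_c$ is the least relation on $\mathcal{M}$ containing $\to_h$ and closed under: if $0\le i<r$, $R_i=a\in\mathbb{A}$ and $\#^{ -1}(a)\to_c M'$, then $\langle\vec R,P,T\rangle\to_c\langle\vec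 R[R_i:=\#M'],P,T\rangle$; if $T=[a_0,\dots,a_n]$, $0\le i\le n$ and $\#^{ -1}(a_i)\to_c M'$, then $\langle\vec R,P,T\rangle\to_c\langle\vec R,P,[a_0,\dots,a_{i-1},\#M',a_{i+1},\dots,a_n]\rangle$. $\twoheadrightarrow_c$ is its reflexive-transitive closure. -}

module Defs where

open import Data.Nat using (ℕ; zero; suc; _<_; _<ᵇ_; _≡ᵇ_)
open import Data.Bool using (Bool; true; false; _∧_; _∨_; if_then_else_; T)
open import Data.Maybe using (Maybe; just; nothing; is-just)
open import Data.List using (List; []; _∷_; _++_; [_]; length)
open import Data.Product using (_×_; _,_; ∃)
open import Function.Bundles using (_↔_; Inverse)
open import Relation.Binary.PropositionalEquality using (_≡_)
open import Relation.Binary.Construct.Closure.ReflexiveTransitive using (Star)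
import Data.List.Relation.Binary.Pointwise as LP
import Data.Maybe.Relation.Binary.Pointwise as MP

-- The grammar  P ::= Load i;P | A,  A ::= App(i,j,k);A | C,
-- C ::= Call i | ε  says exactly that a program is a (possibly empty)
-- block of Loads, followed by a block of Apps, followed by an optional
-- Call.  We represent it in this normal form.

record Program : Set where
  constructor prog
  field
    loads : List ℕ
    apps  : List (ℕ × ℕ × ℕ)
    call  : Maybe ℕ
open Program public

Idx : Set
Idx = ℕ → Bool

insert : ℕ → Idx → Idx
insert k I x = (x ≡ᵇ k) ∨ I x

-- The relation  I ⊨^r P  (decidable; computed by structural recursion,
-- following the clauses of the least relation).
⊨call : Idx → Maybe ℕ → Bool
⊨call I nothing  = true
⊨call I (just i) = I i

⊨apps : ℕ → Idx → List (ℕ × ℕ × ℕ) → Maybe ℕ → Bool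
⊨apps r I []                  c = ⊨call I c
⊨apps r I ((i , j , k) ∷ as) c =
  I i ∧ I j ∧ ⊨apps r (if k <ᵇ r then insert k I else I) as c

⊨loads : ℕ → Idx → List ℕ → List (ℕ × ℕ × ℕ) → Maybe ℕ → Bool
⊨loads r I []       as c = ⊨apps r I as c
⊨loads r I (i ∷ ls) as c = ⊨loads r (if i <ᵇ r then insert i I else I) ls as c

_⊨[_]_ : Idx → ℕ → Program → Bool
I ⊨[ r ] P = ⊨loads r I (loads P) (apps P) (call P)

-- Register i of a register list (∅ = nothing; out of range gives nothing).
reg : {A : Set} → List (Maybe A) → ℕ → Maybe A
reg []       _       = nothing
reg (x ∷ xs) zero    = x
reg (x ∷ xs) (suc i) = reg xs i

-- R[R_i := a]  (unchanged if i ≥ r)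
upd : {X : Set} → List X → ℕ → X → List X
upd []       _       a = []
upd (x ∷ xs) zero    a = a ∷ xs
upd (x ∷ xs) (suc i) a = x ∷ upd xs i a

validFor : {A : Set} → List (Maybe A) → Program → Bool
validFor R P = (λ i → (i <ᵇ length R) ∧ is-just (reg R i)) ⊨[ length R ] P

-- Addressing machines over address set A (∅ represented by nothing).
-- r = length regs.

record Machine (A : Set) : Set where
  field
    regs  : List (Maybe A)
    progm : Program
    tape  : List A
    valid : T (validFor regs progm)
open Machine public

Countable : Set → Set
Countable A = A ↔ ℕ

module AM {A : Set} (enc : Machine A ↔ A) where

  # : Machine A → A
  # = Inverse.to enc

  #⁻¹ : A → Machine A
  #⁻¹ = Inverse.from enc

  _＠_ : Machine A → List A → Machine A
  M ＠ T' = record M { tape = tape M ++ T' }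

  _·_ : A → A → A
  a · b = # (#⁻¹ a ＠ [ b ])

  data _→h_ (M N : Machine A) : Set where
    hLoad : ∀ {i ls a T} →
      loads (progm M) ≡ i ∷ ls → tape M ≡ a ∷ T →
      regs N ≡ upd (regs M) i (just a) →
      progm N ≡ prog ls (apps (progm M)) (call (progm M)) →
      tape N ≡ T → M →h N
    hApp : ∀ {i j k as a b} →
      loads (progm M) ≡ [] → apps (progm M) ≡ (i , j , k) ∷ as →
      reg (regs M) i ≡ just a → reg (regs M) j ≡ just b →
      regs N ≡ upd (regs M) k (just (a · b)) →
      progm N ≡ prog [] as (call (progm M)) →
      tape N ≡ tape M → M →h N
    hCall : ∀ {i a} →
      loads (progm M) ≡ [] → apps (progm M) ≡ [] → call (progm M) ≡ just i →
      reg (regs M) i ≡ just a →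
      N ≡ #⁻¹ a ＠ tape M → M →h N

  _↠h_ : Machine A → Machine A → Set
  _↠h_ = Star _→h_

  mutual
    data _≡𝔸_ : Machine A → Machine A → Set where
      ≡𝔸-step  : ∀ {M Z N} → M ↠h Z → Z =𝔸 N → M ≡𝔸 N
      ≡𝔸-refl  : ∀ {M} → M ≡𝔸 M
      ≡𝔸-sym   : ∀ {M N} → M ≡𝔸 N → N ≡𝔸 M
      ≡𝔸-trans : ∀ {M N P} → M ≡𝔸 N → N ≡𝔸 P → M ≡𝔸 P

    data _≃𝔸_ (a b : A) : Set where
      ≃𝔸-intro : #⁻¹ a ≡𝔸 #⁻¹ b → a ≃𝔸 b

    data _=𝔸_ (M N : Machine A) : Set where
      =𝔸-intro :
        LP.Pointwise (MP.Pointwise _≃𝔸_) (regs M) (regs N) →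
        progm M ≡ progm N →
        LP.Pointwise _≃𝔸_ (tape M) (tape N) → M =𝔸 N

  data _→c_ (M N : Machine A) : Set where
    cHead : M →h N → M →c N
    cReg  : ∀ {i a M'} → i < length (regs M) → reg (regs M) i ≡ just a →
      #⁻¹ a →c M' →
      regs N ≡ upd (regs M) i (just (# M')) → progm N ≡ progm M →
      tape N ≡ tape M → M →c N
    cTape : ∀ {pre a post M'} → tape M ≡ pre ++ a ∷ post →
      #⁻¹ a →c M' →
      regs N ≡ regs M → progm N ≡ progm M →
      tape N ≡ pre ++ # M' ∷ post → M →c N

  _↠c_ : Machine A → Machine A → Set
  _↠c_ = Star _→c_

-- Head reduction is deterministic and commutes with reduction inside the
-- registers and the tape, so the parallel reduction ⇛ which reduces all
-- components at once and then possibly fires one head step has the diamond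
-- property. As →c ⊆ ⇛ ⊆ ↠c, the reduction ↠c is confluent. Every →c step
-- stays inside ≡𝔸, which gives one direction; for the other, each generator
-- of ≡𝔸 is a pair of converging ↠c reductions, and confluence glues them
-- together under transitivity.
{-# OPTIONS --safe #-}
module Submission where

open import Defs
open import Data.Nat using (ℕ; zero; suc; _<_; _<ᵇ_; _≡ᵇ_; s≤s; z≤n)
open import Data.Bool using (Bool; true; false; _∧_; _∨_; if_then_else_; T)
open import Data.Bool.Properties using (T-irrelevant)
open import Data.Maybe using (Maybe; just; nothing; is-just)
open import Data.Maybe.Properties using (just-injective)
open import Data.List using (List; []; _∷_; _++_; [_]; length; map)
open import Data.List.Properties using (++-assoc; length-map; ∷-injective)
open import Data.List.Relation.Binary.Pointwise as Pointwise using (Pointwise; []; _∷_)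
open import Data.Product using (∃; ∃₂; _×_; _,_; -,_; proj₁; proj₂; map₂; swap)
open import Function.Bundles using (_↔_; _⇔_; Inverse; mk⇔)
open import Level using (Level; _⊔_)
open import Relation.Binary.Core using (Rel; _⇒_)
open import Relation.Binary.Definitions using (Reflexive)
open import Relation.Binary.PropositionalEquality
  using (_≡_; refl; sym; trans; cong; subst; subst₂; _≗_)
open import Relation.Binary.Construct.Closure.ReflexiveTransitive
  using (Star; ε; _◅_; _◅◅_; gmap; kleisliStar)
open import Relation.Binary.Construct.Closure.ReflexiveTransitive.Properties using (reflexive)
open import Relation.Binary.Rewriting using (Confluent; Deterministic)
import Data.Maybe.Relation.Binary.Pointwise as MaybePointwise
open MaybePointwise using (just; nothing)

private
  variable
    a ℓ : Level
    X : Set a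

Joinable : {X : Set a} → Rel X ℓ → Rel X (a ⊔ ℓ)
Joinable _∼_ x y = ∃ λ z → x ∼ z × y ∼ z

HasDiamond : Rel X ℓ → Set _
HasDiamond _⟶_ = ∀ {x y z} → x ⟶ y → x ⟶ z → Joinable _⟶_ y z

module _ {_⟶_ : Rel X ℓ} where

  diamond⇒strip : HasDiamond _⟶_ →
    ∀ {s t u} → s ⟶ t → Star _⟶_ s u → ∃ λ v → Star _⟶_ t v × u ⟶ v
  diamond⇒strip ◇ x ε = -, ε , x
  diamond⇒strip ◇ x (y ◅ ys) with ◇ x y
  ... | _ , x′ , y′ with diamond⇒strip ◇ y′ ys
  ... | v , zs , z = v , x′ ◅ zs , z

  diamond⇒confluent : HasDiamond _⟶_ → Confluent _⟶_
  diamond⇒confluent ◇ ε ys = -, ys , ε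
  diamond⇒confluent ◇ (x ◅ xs) ys with diamond⇒strip ◇ x ys
  ... | _ , ys′ , x′ with diamond⇒confluent ◇ xs ys′
  ... | v , zs , zs′ = v , zs , x′ ◅ zs′

  joinable-trans : Confluent _⟶_ →
    ∀ {x y z} → Joinable (Star _⟶_) x y → Joinable (Star _⟶_) y z → Joinable (Star _⟶_) x z
  joinable-trans conf (_ , xs , ys) (_ , ys′ , zs) with conf ys ys′
  ... | w , us , vs = w , xs ◅◅ us , zs ◅◅ vs

confluent-between : {_⟶_ _⇉_ : Rel X ℓ} →
  _⟶_ ⇒ _⇉_ → _⇉_ ⇒ Star _⟶_ → Confluent _⇉_ → Confluent _⟶_
confluent-between ⟶⇒⇉ ⇉⇒⟶* conf xs ys
  with conf (gmap (λ x → x) ⟶⇒⇉ xs) (gmap (λ x → x) ⟶⇒⇉ ys)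
... | z , xs′ , ys′ = z , kleisliStar (λ x → x) ⇉⇒⟶* xs′ , kleisliStar (λ x → x) ⇉⇒⟶* ys′

⊨call-cong : ∀ {I J} → I ≗ J → ∀ c → ⊨call I c ≡ ⊨call J c
⊨call-cong I≗J nothing  = refl
⊨call-cong I≗J (just i) = I≗J i

insert-cong : ∀ {I J} (b : Bool) k → I ≗ J →
  (if b then insert k I else I) ≗ (if b then insert k J else J)
insert-cong true  k I≗J x = cong ((x ≡ᵇ k) ∨_) (I≗J x)
insert-cong false k I≗J   = I≗J

⊨apps-cong : ∀ r {I J} → I ≗ J → ∀ as c → ⊨apps r I as c ≡ ⊨apps r J as c
⊨apps-cong r I≗J []                  c = ⊨call-cong I≗J c
⊨apps-cong r I≗J ((i , j , k) ∷ as) c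
  rewrite I≗J i | I≗J j | ⊨apps-cong r (insert-cong (k <ᵇ r) k I≗J) as c = refl

⊨loads-cong : ∀ r {I J} → I ≗ J → ∀ ls as c → ⊨loads r I ls as c ≡ ⊨loads r J ls as c
⊨loads-cong r I≗J []       = ⊨apps-cong r I≗J
⊨loads-cong r I≗J (i ∷ ls) = ⊨loads-cong r (insert-cong (i <ᵇ r) i I≗J) ls

Shape : List (Maybe X) → List Bool
Shape = map is-just

reg-shape : {R R′ : List (Maybe X)} → Shape R ≡ Shape R′ →
  ∀ i → is-just (reg R i) ≡ is-just (reg R′ i)
reg-shape {R = []}    {[]}     e i       = refl
reg-shape {R = _ ∷ R} {_ ∷ R′} e zero    = proj₁ (∷-injective e)
reg-shape {R = _ ∷ R} {_ ∷ R′} e (suc i) = reg-shape (proj₂ (∷-injective e)) i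

shape-length : {R R′ : List (Maybe X)} → Shape R ≡ Shape R′ → length R ≡ length R′
shape-length {R = R} {R′} e = trans (sym (length-map is-just R)) (trans (cong length e) (length-map is-just R′))

validFor-shape : ∀ {A : Set} {R R′ : List (Maybe A)} P → Shape R ≡ Shape R′ →
  validFor R P ≡ validFor R′ P
validFor-shape {R = R} {R′} P e rewrite shape-length e =
  ⊨loads-cong (length R′) (λ i → cong ((i <ᵇ length R′) ∧_) (reg-shape e i)) (loads P) (apps P) (call P)

upd-upd : {X : Set} (R : List X) (i : ℕ) (x y : X) → upd (upd R i x) i y ≡ upd R i y
upd-upd []      i       x y = refl
upd-upd (_ ∷ R) zero    x y = refl
upd-upd (z ∷ R) (suc i) x y = cong (z ∷_) (upd-upd R i x y)

upd-++ : {X : Set} (pre : List X) (x : X) (R : List X) (y : X) →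
  upd (pre ++ x ∷ R) (length pre) y ≡ pre ++ y ∷ R
upd-++ []        x R y = refl
upd-++ (z ∷ pre) x R y = cong (z ∷_) (upd-++ pre x R y)

∷-++-snoc : ∀ (pre : List X) x R → pre ++ x ∷ R ≡ (pre ++ [ x ]) ++ R
∷-++-snoc pre x R = sym (++-assoc pre [ x ] R)

module _ {A : Set} where

  machine-≡ : {M N : Machine A} → regs M ≡ regs N → progm M ≡ progm N → tape M ≡ tape N → M ≡ N
  machine-≡ {record { valid = v }} {record { valid = w }} refl refl refl
    = cong (λ v → record { valid = v }) (T-irrelevant v w)

  withRegsTape : (M : Machine A) (R : List (Maybe A)) (U : List A) → Shape (regs M) ≡ Shape R → Machine A
  withRegsTape M R U e = record
    { regs = R ; progm = progm M ; tape = U ; valid = subst T (validFor-shape (progm M) e) (valid M) }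

  reg-just⇒< : ∀ (R : List (Maybe A)) i {a} → reg R i ≡ just a → i < length R
  reg-just⇒< (_ ∷ R) zero    _ = s≤s z≤n
  reg-just⇒< (_ ∷ R) (suc i) e = s≤s (reg-just⇒< R i e)

  reg-upd : ∀ (R : List (Maybe A)) i x → i < length R → reg (upd R i x) i ≡ x
  reg-upd (_ ∷ R) zero    x _         = refl
  reg-upd (_ ∷ R) (suc i) x (s≤s i<r) = reg-upd R i x i<r

  upd-reg : ∀ (R : List (Maybe A)) i → upd R i (reg R i) ≡ R
  upd-reg []      i       = refl
  upd-reg (_ ∷ R) zero    = refl
  upd-reg (x ∷ R) (suc i) = cong (x ∷_) (upd-reg R i)

  upd-shape : ∀ (R : List (Maybe A)) i {a} b → reg R i ≡ just a → Shape (upd R i (just b)) ≡ Shape R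
  upd-shape []             i       b _ = refl
  upd-shape (just _ ∷ R)   zero    b _ = refl
  upd-shape (x ∷ R)        (suc i) b e = cong (is-just x ∷_) (upd-shape R i b e)

  reg-++ : ∀ (pre : List (Maybe A)) x R → reg (pre ++ x ∷ R) (length pre) ≡ x
  reg-++ []        x R = refl
  reg-++ (_ ∷ pre) x R = reg-++ pre x R

RegsPointwise : Rel X ℓ → Rel (List (Maybe X)) _
RegsPointwise _∼_ = Pointwise (MaybePointwise.Pointwise _∼_)

module _ {A : Set} {_∼_ : Rel A ℓ} where

  Pointwise-shape : ∀ {R R′} → RegsPointwise _∼_ R R′ → Shape R ≡ Shape R′
  Pointwise-shape []            = refl
  Pointwise-shape (nothing ∷ r) = cong (false ∷_) (Pointwise-shape r)
  Pointwise-shape (just _ ∷ r)  = cong (true ∷_) (Pointwise-shape r)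

  RegsPointwise-refl : Reflexive _∼_ → Reflexive (RegsPointwise _∼_)
  RegsPointwise-refl ∼-refl = Pointwise.refl (MaybePointwise.refl ∼-refl)

  Pointwise-upd : Reflexive _∼_ → ∀ R i {a b} → reg R i ≡ just a → a ∼ b →
    RegsPointwise _∼_ R (upd R i (just b))
  Pointwise-upd ∼-refl (just _ ∷ R) zero    refl a∼b = just a∼b ∷ RegsPointwise-refl ∼-refl
  Pointwise-upd ∼-refl (x ∷ R)      (suc i) e    a∼b = MaybePointwise.refl ∼-refl ∷ Pointwise-upd ∼-refl R i e a∼b

  Pointwise-upd₂ : ∀ {R R′ a b} i → RegsPointwise _∼_ R R′ → a ∼ b →
    RegsPointwise _∼_ (upd R i (just a)) (upd R′ i (just b))
  Pointwise-upd₂ i       []      a∼b = []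
  Pointwise-upd₂ zero    (_ ∷ r) a∼b = just a∼b ∷ r
  Pointwise-upd₂ (suc i) (x ∷ r) a∼b = x ∷ Pointwise-upd₂ i r a∼b

  Pointwise-reg : ∀ {R R′} → RegsPointwise _∼_ R R′ → ∀ i {a} → reg R i ≡ just a →
    ∃ λ b → reg R′ i ≡ just b × a ∼ b
  Pointwise-reg (just a∼b ∷ r) zero    refl = -, refl , a∼b
  Pointwise-reg (_ ∷ r)                       (suc i) e    = Pointwise-reg r i e

  Pointwise-at : Reflexive _∼_ → ∀ pre {a b} post → a ∼ b →
    Pointwise _∼_ (pre ++ a ∷ post) (pre ++ b ∷ post)
  Pointwise-at ∼-refl pre post a∼b = Pointwise.++⁺ (Pointwise.refl ∼-refl) (a∼b ∷ Pointwise.refl ∼-refl)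

  Pointwise-uncons : ∀ {U V a U₀} → Pointwise _∼_ U V → U ≡ a ∷ U₀ →
    ∃₂ λ b V₀ → V ≡ b ∷ V₀ × a ∼ b × Pointwise _∼_ U₀ V₀
  Pointwise-uncons (a∼b ∷ t) refl = -, -, refl , a∼b , t

record Componentwise {A : Set} (_∼_ : Rel A ℓ) (M N : Machine A) : Set ℓ where
  constructor components
  field
    regs∼  : RegsPointwise _∼_ (regs M) (regs N)
    progm≡ : progm M ≡ progm N
    tape∼  : Pointwise _∼_ (tape M) (tape N)

module _ {A : Set} {_∼_ : Rel A ℓ} where

  Componentwise-refl : Reflexive _∼_ → Reflexive (Componentwise _∼_)
  Componentwise-refl ∼-refl = components (RegsPointwise-refl ∼-refl) refl (Pointwise.refl ∼-refl)

  Componentwise-joinable : ∀ {M N R U} →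
    RegsPointwise _∼_ (regs M) R → RegsPointwise _∼_ (regs N) R → progm M ≡ progm N →
    Pointwise _∼_ (tape M) U → Pointwise _∼_ (tape N) U → Joinable (Componentwise _∼_) M N
  Componentwise-joinable {M} {R = R} {U} rM rN e tM tN =
    withRegsTape M R U (Pointwise-shape rM) , components rM refl tM , components rN (sym e) tN

  Componentwise-reg : Reflexive _∼_ → ∀ {M N i a b} → reg (regs M) i ≡ just a → a ∼ b →
    regs N ≡ upd (regs M) i (just b) → progm N ≡ progm M → tape N ≡ tape M → Componentwise _∼_ M N
  Componentwise-reg ∼-refl {M} {i = i} ra a∼b r p u = components
    (subst (RegsPointwise _∼_ (regs M)) (sym r) (Pointwise-upd ∼-refl (regs M) i ra a∼b))
    (sym p)
    (subst (Pointwise _∼_ (tape M)) (sym u) (Pointwise.refl ∼-refl))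

  Componentwise-tape : Reflexive _∼_ → ∀ {M N pre a b post} → tape M ≡ pre ++ a ∷ post → a ∼ b →
    regs N ≡ regs M → progm N ≡ progm M → tape N ≡ pre ++ b ∷ post → Componentwise _∼_ M N
  Componentwise-tape ∼-refl {M} {pre = pre} {post = post} tm a∼b r p u = components
    (subst (RegsPointwise _∼_ (regs M)) (sym r) (RegsPointwise-refl ∼-refl))
    (sym p)
    (subst₂ (Pointwise _∼_) (sym tm) (sym u) (Pointwise-at ∼-refl pre post a∼b))

module _ {A : Set} (enc : Machine A ↔ A) where
  open AM enc

  from-to : ∀ M → #⁻¹ (# M) ≡ M
  from-to = Inverse.strictlyInverseʳ enc

  to-from : ∀ a → # (#⁻¹ a) ≡ a
  to-from = Inverse.strictlyInverseˡ enc

  reencode : (_∼_ : Rel (Machine A) ℓ) → ∀ {M N} → M ∼ N → M ∼ #⁻¹ (# N)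
  reencode _∼_ {N = N} = subst (_ ∼_) (sym (from-to N))

  Componentwise-＠ : ∀ {_∼_ : Rel A ℓ} {M N U V} →
    Componentwise _∼_ M N → Pointwise _∼_ U V → Componentwise _∼_ (M ＠ U) (N ＠ V)
  Componentwise-＠ (components r p t) u = components r p (Pointwise.++⁺ t u)

  ＠-++ : ∀ M U V → (M ＠ U) ＠ V ≡ M ＠ (U ++ V)
  ＠-++ M U V = machine-≡ refl refl (++-assoc (tape M) U V)

  →h-＠ : ∀ {M N} U → M →h N → (M ＠ U) →h (N ＠ U)
  →h-＠ U (hLoad l t r p u)     = hLoad l (cong (_++ U) t) r p (cong (_++ U) u)
  →h-＠ U (hApp l s ra rb r p u) = hApp l s ra rb r p (cong (_++ U) u)
  →h-＠ {M} U (hCall {a = a} l s c ra e) = hCall l s c ra (trans (cong (_＠ U) e) (＠-++ (#⁻¹ a) (tape M) U))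

  →h-deterministic : Deterministic _≡_ _→h_
  →h-deterministic (hLoad l t r p u) (hLoad l′ t′ r′ p′ u′)
    with ∷-injective (trans (sym l) l′) | ∷-injective (trans (sym t) t′)
  ... | refl , refl | refl , refl = machine-≡ (trans r (sym r′)) (trans p (sym p′)) (trans u (sym u′))
  →h-deterministic (hApp l s ra rb r p u) (hApp l′ s′ ra′ rb′ r′ p′ u′)
    with ∷-injective (trans (sym s) s′)
  ... | refl , refl with just-injective (trans (sym ra) ra′) | just-injective (trans (sym rb) rb′)
  ... | refl | refl = machine-≡ (trans r (sym r′)) (trans p (sym p′)) (trans u (sym u′))
  →h-deterministic (hCall l s c ra e) (hCall l′ s′ c′ ra′ e′)
    with just-injective (trans (sym c) c′)
  ... | refl with just-injective (trans (sym ra) ra′)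
  ... | refl = trans e (sym e′)
  →h-deterministic (hLoad l _ _ _ _)     (hApp l′ _ _ _ _ _ _) with trans (sym l) l′
  ... | ()
  →h-deterministic (hLoad l _ _ _ _)     (hCall l′ _ _ _ _)    with trans (sym l) l′
  ... | ()
  →h-deterministic (hApp l _ _ _ _ _ _) (hLoad l′ _ _ _ _)    with trans (sym l′) l
  ... | ()
  →h-deterministic (hApp _ s _ _ _ _ _) (hCall _ s′ _ _ _)    with trans (sym s) s′
  ... | ()
  →h-deterministic (hCall l _ _ _ _)    (hLoad l′ _ _ _ _)    with trans (sym l′) l
  ... | ()
  →h-deterministic (hCall _ s _ _ _)    (hApp _ s′ _ _ _ _ _) with trans (sym s′) s
  ... | ()

  infix 4 _⇛_ _⇛ᵃ_

  mutual
    data _⇛_ (M : Machine A) : Machine A → Set where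
      ⇛-refl : M ⇛ M
      ⇛-par  : ∀ {N} → Componentwise _⇛ᵃ_ M N → M ⇛ N
      ⇛-head : ∀ {M′ N} → Componentwise _⇛ᵃ_ M M′ → M′ →h N → M ⇛ N

    data _⇛ᵃ_ (a b : A) : Set where
      wrap : #⁻¹ a ⇛ #⁻¹ b → a ⇛ᵃ b

  ⇛ᵃ-refl : Reflexive _⇛ᵃ_
  ⇛ᵃ-refl = wrap ⇛-refl

  ⇛ᵃ-encode : ∀ {a M} → #⁻¹ a ⇛ M → a ⇛ᵃ # M
  ⇛ᵃ-encode d = wrap (reencode _⇛_ d)

  ⇛-＠ : ∀ {M N U V} → M ⇛ N → Pointwise _⇛ᵃ_ U V → (M ＠ U) ⇛ (N ＠ V)
  ⇛-＠ ⇛-refl       t = ⇛-par (Componentwise-＠ (Componentwise-refl ⇛ᵃ-refl) t)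
  ⇛-＠ (⇛-par c)    t = ⇛-par (Componentwise-＠ c t)
  ⇛-＠ (⇛-head c h) t = ⇛-head (Componentwise-＠ c t) (→h-＠ _ h)

  ·-⇛ᵃ : ∀ {a a′ b b′} → a ⇛ᵃ a′ → b ⇛ᵃ b′ → (a · b) ⇛ᵃ (a′ · b′)
  ·-⇛ᵃ {a} {a′} {b} (wrap d) b⇛b′ =
    ⇛ᵃ-encode (subst (_⇛ #⁻¹ a′ ＠ _) (sym (from-to (#⁻¹ a ＠ [ b ]))) (⇛-＠ d (b⇛b′ ∷ [])))

  →h-commutes-⇛ : ∀ {M N M′} → M →h N → Componentwise _⇛ᵃ_ M M′ → ∃ λ N′ → M′ →h N′ × N ⇛ N′
  →h-commutes-⇛ {N = N} {M′} (hLoad {i} {ls} l t r p u) (components rs e ts)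
    with Pointwise-uncons ts t
  ... | a′ , T′ , t′ , a⇛a′ , T⇛T′ =
    withRegsTape N _ T′ (Pointwise-shape rs′) ,
    hLoad (trans (cong loads (sym e)) l) t′ refl (trans p (cong (λ P → prog ls (apps P) (call P)) e)) refl ,
    ⇛-par (components rs′ refl (subst (λ U → Pointwise _⇛ᵃ_ U T′) (sym u) T⇛T′))
    where
    rs′ : RegsPointwise _⇛ᵃ_ (regs N) (upd (regs M′) i (just a′))
    rs′ = subst (λ R → RegsPointwise _⇛ᵃ_ R _) (sym r) (Pointwise-upd₂ i rs a⇛a′)
  →h-commutes-⇛ {N = N} {M′} (hApp {i} {j} {k} {as} l s ra rb r p u) (components rs e ts)
    with Pointwise-reg rs i ra | Pointwise-reg rs j rb
  ... | a′ , ra′ , a⇛a′ | b′ , rb′ , b⇛b′ =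
    withRegsTape N _ (tape M′) (Pointwise-shape rs′) ,
    hApp (trans (cong loads (sym e)) l) (trans (cong apps (sym e)) s) ra′ rb′ refl
      (trans p (cong (λ P → prog [] as (call P)) e)) refl ,
    ⇛-par (components rs′ refl (subst (λ U → Pointwise _⇛ᵃ_ U (tape M′)) (sym u) ts))
    where
    rs′ : RegsPointwise _⇛ᵃ_ (regs N) (upd (regs M′) k (just (a′ · b′)))
    rs′ = subst (λ R → RegsPointwise _⇛ᵃ_ R _) (sym r) (Pointwise-upd₂ k rs (·-⇛ᵃ a⇛a′ b⇛b′))
  →h-commutes-⇛ {M′ = M′} (hCall {i} l s c ra e) (components rs e′ ts)
    with Pointwise-reg rs i ra
  ... | b , rb , wrap d =
    #⁻¹ b ＠ tape M′ ,
    hCall (trans (cong loads (sym e′)) l) (trans (cong apps (sym e′)) s) (trans (cong call (sym e′)) c)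
      rb refl ,
    subst (_⇛ _) (sym e) (⇛-＠ d ts)

  mutual
    ⇛-diamond : HasDiamond _⇛_
    ⇛-diamond ⇛-refl d      = -, d , ⇛-refl
    ⇛-diamond d      ⇛-refl = -, ⇛-refl , d
    ⇛-diamond (⇛-par c₁) (⇛-par c₂) with components-⇛-diamond c₁ c₂
    ... | X , c₁′ , c₂′ = X , ⇛-par c₁′ , ⇛-par c₂′
    ⇛-diamond (⇛-par c₁) (⇛-head c₂ h₂) with components-⇛-diamond c₁ c₂
    ... | X , c₁′ , c₂′ with →h-commutes-⇛ h₂ c₂′
    ... | Y , h , d = Y , ⇛-head c₁′ h , d
    ⇛-diamond (⇛-head c₁ h₁) (⇛-par c₂) with components-⇛-diamond c₁ c₂
    ... | X , c₁′ , c₂′ with →h-commutes-⇛ h₁ c₁′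
    ... | Y , h , d = Y , d , ⇛-head c₂′ h
    ⇛-diamond (⇛-head c₁ h₁) (⇛-head c₂ h₂) with components-⇛-diamond c₁ c₂
    ... | X , c₁′ , c₂′ with →h-commutes-⇛ h₁ c₁′ | →h-commutes-⇛ h₂ c₂′
    ... | Y₁ , h₁′ , d₁ | Y₂ , h₂′ , d₂ = Y₂ , subst (_ ⇛_) (→h-deterministic h₁′ h₂′) d₁ , d₂

    components-⇛-diamond : HasDiamond (Componentwise _⇛ᵃ_)
    components-⇛-diamond (components r₁ e₁ t₁) (components r₂ e₂ t₂)
      with regs-⇛ᵃ-diamond r₁ r₂ | tape-⇛ᵃ-diamond t₁ t₂
    ... | _ , s₁ , s₂ | _ , u₁ , u₂ = Componentwise-joinable s₁ s₂ (trans (sym e₁) e₂) u₁ u₂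

    ⇛ᵃ-diamond : HasDiamond _⇛ᵃ_
    ⇛ᵃ-diamond (wrap d₁) (wrap d₂) with ⇛-diamond d₁ d₂
    ... | X , e₁ , e₂ = # X , ⇛ᵃ-encode e₁ , ⇛ᵃ-encode e₂

    regs-⇛ᵃ-diamond : HasDiamond (RegsPointwise _⇛ᵃ_)
    regs-⇛ᵃ-diamond [] [] = -, [] , []
    regs-⇛ᵃ-diamond (nothing ∷ r₁) (nothing ∷ r₂) with regs-⇛ᵃ-diamond r₁ r₂
    ... | R , s₁ , s₂ = nothing ∷ R , nothing ∷ s₁ , nothing ∷ s₂
    regs-⇛ᵃ-diamond (just d₁ ∷ r₁) (just d₂ ∷ r₂)
      with ⇛ᵃ-diamond d₁ d₂ | regs-⇛ᵃ-diamond r₁ r₂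
    ... | x , e₁ , e₂ | R , s₁ , s₂ = just x ∷ R , just e₁ ∷ s₁ , just e₂ ∷ s₂

    tape-⇛ᵃ-diamond : HasDiamond (Pointwise _⇛ᵃ_)
    tape-⇛ᵃ-diamond [] [] = -, [] , []
    tape-⇛ᵃ-diamond (d₁ ∷ t₁) (d₂ ∷ t₂) with ⇛ᵃ-diamond d₁ d₂ | tape-⇛ᵃ-diamond t₁ t₂
    ... | x , e₁ , e₂ | U , u₁ , u₂ = x ∷ U , e₁ ∷ u₁ , e₂ ∷ u₂

  →c⇒⇛ : ∀ {M N} → M →c N → M ⇛ N
  →c⇒⇛ (cHead h) = ⇛-head (Componentwise-refl ⇛ᵃ-refl) h
  →c⇒⇛ (cReg _ ra s r p u) = ⇛-par (Componentwise-reg ⇛ᵃ-refl ra (⇛ᵃ-encode (→c⇒⇛ s)) r p u)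
  →c⇒⇛ (cTape tm s r p u) = ⇛-par (Componentwise-tape ⇛ᵃ-refl tm (⇛ᵃ-encode (→c⇒⇛ s)) r p u)

  _↠ᵃ_ : Rel A _
  a ↠ᵃ b = #⁻¹ a ↠c #⁻¹ b

  ↠c-reg : ∀ {M N i a b} → reg (regs M) i ≡ just a → a ↠ᵃ b →
    regs N ≡ upd (regs M) i (just b) → progm N ≡ progm M → tape N ≡ tape M → M ↠c N
  ↠c-reg {M} {i = i} {b = b} ra s r =
    go ra refl s (trans r (cong (λ x → upd (regs M) i (just x)) (sym (to-from b))))
    where
    -- Y is kept apart from #⁻¹ a so that the reduction sequence stays a variable to recurse on.
    go : ∀ {M N i a Y Z} → reg (regs M) i ≡ just a → #⁻¹ a ≡ Y → Y ↠c Z →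
      regs N ≡ upd (regs M) i (just (# Z)) → progm N ≡ progm M → tape N ≡ tape M → M ↠c N
    go {M} {N} {i} {a} ra refl ε r p u = reflexive _→c_ (machine-≡ (sym r′) (sym p) (sym u))
      where
      r′ : regs N ≡ regs M
      r′ = trans r (trans (cong (λ x → upd (regs M) i (just x)) (to-from a))
                          (trans (cong (upd (regs M) i) (sym ra)) (upd-reg (regs M) i)))
    go {M} {N} {i} {Z = Z} ra refl (_◅_ {j = Y} s ss) r p u =
      cReg i<r ra s refl refl refl ◅ go {M₁} {N} (reg-upd (regs M) i _ i<r) (from-to Y) ss r₁ p u
      where
      i<r : i < length (regs M)
      i<r = reg-just⇒< (regs M) i ra
      M₁ : Machine A
      M₁ = withRegsTape M (upd (regs M) i (just (# Y))) (tape M) (sym (upd-shape (regs M) i (# Y) ra))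
      r₁ : regs N ≡ upd (regs M₁) i (just (# Z))
      r₁ = trans r (sym (upd-upd (regs M) i (just (# Y)) (just (# Z))))

  ↠c-tape : ∀ {M N pre a b post} → tape M ≡ pre ++ a ∷ post → a ↠ᵃ b →
    tape N ≡ pre ++ b ∷ post → regs N ≡ regs M → progm N ≡ progm M → M ↠c N
  ↠c-tape {pre = pre} {b = b} {post} tm s u =
    go tm refl s (trans u (cong (λ x → pre ++ x ∷ post) (sym (to-from b))))
    where
    go : ∀ {M N pre a post Y Z} → tape M ≡ pre ++ a ∷ post → #⁻¹ a ≡ Y → Y ↠c Z →
      tape N ≡ pre ++ # Z ∷ post → regs N ≡ regs M → progm N ≡ progm M → M ↠c N
    go {pre = pre} {a} {post} tm refl ε u r p =
      reflexive _→c_ (machine-≡ (sym r) (sym p)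
        (trans tm (sym (trans u (cong (λ x → pre ++ x ∷ post) (to-from a))))))
    go {M} {N} {pre} {post = post} tm refl (_◅_ {j = Y} s ss) u r p =
      cTape tm s refl refl refl ◅ go {M₁} {N} refl (from-to Y) ss u r p
      where
      M₁ : Machine A
      M₁ = withRegsTape M (regs M) (pre ++ # Y ∷ post) refl

  ↠c-regs : ∀ {M N} pre {R R′} → regs M ≡ pre ++ R → RegsPointwise _↠ᵃ_ R R′ →
    regs N ≡ pre ++ R′ → progm N ≡ progm M → tape N ≡ tape M → M ↠c N
  ↠c-regs pre rM [] rN p u = reflexive _→c_ (machine-≡ (trans rM (sym rN)) (sym p) (sym u))
  ↠c-regs pre {nothing ∷ R} {_ ∷ R′} rM (nothing ∷ r) rN =
    ↠c-regs (pre ++ [ nothing ]) (trans rM (∷-++-snoc pre nothing R)) r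
      (trans rN (∷-++-snoc pre nothing R′))
  ↠c-regs {M} {N} pre {just a ∷ R} {just b ∷ R′} rM (just s ∷ r) rN p u =
    ↠c-reg {M} {M₁} ra s refl refl refl ◅◅
    ↠c-regs {M₁} {N} (pre ++ [ just b ]) r₁ r (trans rN (∷-++-snoc pre (just b) R′)) p u
    where
    ra : reg (regs M) (length pre) ≡ just a
    ra = trans (cong (λ R → reg R (length pre)) rM) (reg-++ pre (just a) R)
    M₁ : Machine A
    M₁ = withRegsTape M (upd (regs M) (length pre) (just b)) (tape M) (sym (upd-shape (regs M) (length pre) b ra))
    r₁ : regs M₁ ≡ (pre ++ [ just b ]) ++ R
    r₁ = trans (cong (λ R → upd R (length pre) (just b)) rM)
               (trans (upd-++ pre (just a) R (just b)) (∷-++-snoc pre (just b) R))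

  ↠c-tapes : ∀ {M N} pre {U U′} → tape M ≡ pre ++ U → Pointwise _↠ᵃ_ U U′ →
    tape N ≡ pre ++ U′ → regs N ≡ regs M → progm N ≡ progm M → M ↠c N
  ↠c-tapes pre tM [] tN r p = reflexive _→c_ (machine-≡ (sym r) (sym p) (trans tM (sym tN)))
  ↠c-tapes {M} {N} pre {a ∷ U} {b ∷ U′} tM (s ∷ t) tN r p =
    ↠c-tape {M} {M₁} tM s refl refl refl ◅◅
    ↠c-tapes {M₁} {N} (pre ++ [ b ]) (∷-++-snoc pre b U) t (trans tN (∷-++-snoc pre b U′)) r p
    where
    M₁ : Machine A
    M₁ = withRegsTape M (regs M) (pre ++ b ∷ U) refl

  Componentwise-↠c : ∀ {M N} → Componentwise _↠ᵃ_ M N → M ↠c N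
  Componentwise-↠c {M} {N} (components r e t) =
    ↠c-regs {M} {M₁} [] refl r refl refl refl ◅◅ ↠c-tapes {M₁} {N} [] refl t refl refl (sym e)
    where
    M₁ : Machine A
    M₁ = withRegsTape M (regs N) (tape M) (Pointwise-shape r)

  mutual
    ⇛⇒↠c : ∀ {M N} → M ⇛ N → M ↠c N
    ⇛⇒↠c ⇛-refl       = ε
    ⇛⇒↠c (⇛-par c)    = Componentwise-↠c (components-⇛ᵃ⇒↠ᵃ c)
    ⇛⇒↠c (⇛-head c h) = Componentwise-↠c (components-⇛ᵃ⇒↠ᵃ c) ◅◅ cHead h ◅ ε

    components-⇛ᵃ⇒↠ᵃ : ∀ {M N} → Componentwise _⇛ᵃ_ M N → Componentwise _↠ᵃ_ M N
    components-⇛ᵃ⇒↠ᵃ (components r e t) = components (regs-⇛ᵃ⇒↠ᵃ r) e (tape-⇛ᵃ⇒↠ᵃ t)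

    regs-⇛ᵃ⇒↠ᵃ : ∀ {R R′} → RegsPointwise _⇛ᵃ_ R R′ → RegsPointwise _↠ᵃ_ R R′
    regs-⇛ᵃ⇒↠ᵃ []                  = []
    regs-⇛ᵃ⇒↠ᵃ (nothing ∷ r)       = nothing ∷ regs-⇛ᵃ⇒↠ᵃ r
    regs-⇛ᵃ⇒↠ᵃ (just (wrap d) ∷ r) = just (⇛⇒↠c d) ∷ regs-⇛ᵃ⇒↠ᵃ r

    tape-⇛ᵃ⇒↠ᵃ : ∀ {U U′} → Pointwise _⇛ᵃ_ U U′ → Pointwise _↠ᵃ_ U U′
    tape-⇛ᵃ⇒↠ᵃ []           = []
    tape-⇛ᵃ⇒↠ᵃ (wrap d ∷ t) = ⇛⇒↠c d ∷ tape-⇛ᵃ⇒↠ᵃ t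

  ↠c-confluent : Confluent _→c_
  ↠c-confluent = confluent-between →c⇒⇛ ⇛⇒↠c (diamond⇒confluent ⇛-diamond)

  ≃𝔸-refl : Reflexive _≃𝔸_
  ≃𝔸-refl = ≃𝔸-intro ≡𝔸-refl

  ≃𝔸-encode : ∀ {a M} → #⁻¹ a ≡𝔸 M → a ≃𝔸 # M
  ≃𝔸-encode e = ≃𝔸-intro (reencode _≡𝔸_ e)

  Componentwise⇒=𝔸 : ∀ {M N} → Componentwise _≃𝔸_ M N → M =𝔸 N
  Componentwise⇒=𝔸 (components r p t) = =𝔸-intro r p t

  →c⇒≡𝔸 : ∀ {M N} → M →c N → M ≡𝔸 N
  →c⇒≡𝔸 (cHead h) = ≡𝔸-step (h ◅ ε) (Componentwise⇒=𝔸 (Componentwise-refl ≃𝔸-refl))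
  →c⇒≡𝔸 (cReg _ ra s r p u) =
    ≡𝔸-step ε (Componentwise⇒=𝔸 (Componentwise-reg ≃𝔸-refl ra (≃𝔸-encode (→c⇒≡𝔸 s)) r p u))
  →c⇒≡𝔸 (cTape tm s r p u) =
    ≡𝔸-step ε (Componentwise⇒=𝔸 (Componentwise-tape ≃𝔸-refl tm (≃𝔸-encode (→c⇒≡𝔸 s)) r p u))

  ↠c⇒≡𝔸 : ∀ {M N} → M ↠c N → M ≡𝔸 N
  ↠c⇒≡𝔸 ε        = ≡𝔸-refl
  ↠c⇒≡𝔸 (s ◅ ss) = ≡𝔸-trans (→c⇒≡𝔸 s) (↠c⇒≡𝔸 ss)

  joinable⇒≡𝔸 : ∀ {M N} → Joinable _↠c_ M N → M ≡𝔸 N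
  joinable⇒≡𝔸 (_ , s , t) = ≡𝔸-trans (↠c⇒≡𝔸 s) (≡𝔸-sym (↠c⇒≡𝔸 t))

  mutual
    ≡𝔸⇒joinable : ∀ {M N} → M ≡𝔸 N → Joinable _↠c_ M N
    ≡𝔸⇒joinable (≡𝔸-step h e) with =𝔸⇒joinable e
    ... | X , s , t = X , gmap (λ x → x) cHead h ◅◅ s , t
    ≡𝔸⇒joinable ≡𝔸-refl           = -, ε , ε
    ≡𝔸⇒joinable (≡𝔸-sym e)        = map₂ swap (≡𝔸⇒joinable e)
    ≡𝔸⇒joinable (≡𝔸-trans e₁ e₂) = joinable-trans ↠c-confluent (≡𝔸⇒joinable e₁) (≡𝔸⇒joinable e₂)

    =𝔸⇒joinable : ∀ {M N} → M =𝔸 N → Joinable _↠c_ M N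
    =𝔸⇒joinable (=𝔸-intro r e t) with regs-≃𝔸⇒joinable r | tape-≃𝔸⇒joinable t
    ... | _ , sM , sN | _ , uM , uN with Componentwise-joinable sM sN e uM uN
    ... | X , cM , cN = X , Componentwise-↠c cM , Componentwise-↠c cN

    ≃𝔸⇒joinable : ∀ {a b} → a ≃𝔸 b → Joinable _↠ᵃ_ a b
    ≃𝔸⇒joinable (≃𝔸-intro e) with ≡𝔸⇒joinable e
    ... | X , s , t = # X , reencode _↠c_ s , reencode _↠c_ t

    regs-≃𝔸⇒joinable : ∀ {R R′} → RegsPointwise _≃𝔸_ R R′ →
      Joinable (RegsPointwise _↠ᵃ_) R R′
    regs-≃𝔸⇒joinable [] = -, [] , []
    regs-≃𝔸⇒joinable (nothing ∷ r) with regs-≃𝔸⇒joinable r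
    ... | R , s , t = nothing ∷ R , nothing ∷ s , nothing ∷ t
    regs-≃𝔸⇒joinable (just e ∷ r) with ≃𝔸⇒joinable e | regs-≃𝔸⇒joinable r
    ... | x , s , t | R , ss , ts = just x ∷ R , just s ∷ ss , just t ∷ ts

    tape-≃𝔸⇒joinable : ∀ {U U′} → Pointwise _≃𝔸_ U U′ → Joinable (Pointwise _↠ᵃ_) U U′
    tape-≃𝔸⇒joinable [] = -, [] , []
    tape-≃𝔸⇒joinable (e ∷ r) with ≃𝔸⇒joinable e | tape-≃𝔸⇒joinable r
    ... | x , s , t | U , ss , ts = x ∷ U , s ∷ ss , t ∷ ts

theorem3p11 : (A : Set) → Countable A → (enc : Machine A ↔ A) →
    (M N : Machine A) →
    AM._≡𝔸_ enc M N ⇔ ∃ (λ Z → AM._↠c_ enc M Z × AM._↠c_ enc N Z)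
theorem3p11 A _ enc M N = mk⇔ (≡𝔸⇒joinable enc) (joinable⇒≡𝔸 enc)
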